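{- Let $q\in\mathbb{Q}\cap\mathbb{Z}_2$ and let $a,k,b,v\in\mathbb{N}$ with $a<2^k$, $b<2^v$ and $q=a+2^k\bar{b}_{v,\infty}$. Let $m=\alpha(b)$ and let $t$ be a positive integer. Then $$\Phi\left(a+2^k\bar{b}_{v,t}\right)=\Phi(q)-\frac{\Phi\left(\bar{b}_{v,\infty}\right)}{3^{mt+\alpha(a)}}2^{k+tv}.$$
   Context: $\mathbb{Z}_2$ is the ring of $2$-adic integers; $\mathbb{N}=\{0,1,2,\dots\}$. The map $\Phi:\mathbb{Z}_2\to\mathbb{Z}_2$ is defined as follows: if $x=\sum_i 2^{e_i}$ with $0\leq e_0<e_1<\cdots$ (finite or infinite sum; $x=0$ is the empty sum), then $\Phi(x)=-\sum_i 2^{e_i}3^{ -i}$ ($\Phi(0)=0$). For $a\in\mathbb{N}$, $\alpha(a)$ is the number of ones in the binary expansion of $a$. For $b,v,t\in\mathbb{N}$, $\bar{b}_{v,t}=b\sum_{i=0}^{t-1}2^{vi}$ and $\bar{b}_{v,\infty}=b\sum_{i=0}^{\infty}2^{vi}$ (a $2$-adic integer). -}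

module Defs where

open import Data.Nat as ℕ using (ℕ; zero; suc; _<_; _≤_; _%_; _/_)
open import Data.Integer as ℤ using (+_)
open import Data.Rational as ℚ using (ℚ; 0ℚ; 1ℚ; ↧ₙ_; _-_; _*_; _+_)
open import Data.Nat.Properties using (m^n≢0)
open import Data.Product using (∃; _×_)
open import Relation.Binary.PropositionalEquality using (_≡_)

⟦_⟧ : ℕ → ℚ
⟦ n ⟧ = (+ n) ℚ./ 1

_^ℚ_ : ℚ → ℕ → ℚ
x ^ℚ zero = 1ℚ
x ^ℚ suc n = x * (x ^ℚ n)

third : ℚ
third = (+ 1) ℚ./ 3

inv3^ : ℕ → ℚ
inv3^ j = third ^ℚ j

-- ℚ ∩ ℤ₂ : rationals with odd (reduced) denominator
InZ₂ : ℚ → Set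
InZ₂ r = (↧ₙ r) % 2 ≡ 1

_≡_[mod2^_] : ℚ → ℚ → ℕ → Set
x ≡ y [mod2^ n ] = ∃ λ z → InZ₂ z × (x - y ≡ ⟦ 2 ℕ.^ n ⟧ * z)

bit : ℕ → ℕ → ℕ
bit e x = _/_ x (2 ℕ.^ e) {{m^n≢0 2 e}} % 2

popBelow : ℕ → ℕ → ℕ
popBelow zero    x = 0
popBelow (suc e) x = popBelow e x ℕ.+ bit e x

-- α(a): number of ones in binary expansion (a < 2^a, so positions < a suffice)
α : ℕ → ℕ
α a = popBelow a a

-- partial Φ sum over binary positions < L:  - Σ_{e_i < L} 2^{e_i} 3^{-i}
ΦUpTo : ℕ → ℕ → ℚ
ΦUpTo zero    x = 0ℚ
ΦUpTo (suc e) x = ΦUpTo e x - (⟦ bit e x ℕ.* 2 ℕ.^ e ⟧ * inv3^ (popBelow e x))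

-- Φ on natural numbers (finite binary expansion; x < 2^x)
Φℕ : ℕ → ℚ
Φℕ x = ΦUpTo x x

bbar : ℕ → ℕ → ℕ → ℕ
bbar b v zero    = 0
bbar b v (suc t) = bbar b v t ℕ.+ b ℕ.* 2 ℕ.^ (v ℕ.* t)

-- s is the residue of the 2-adic integer b̄_{v,∞} modulo 2^n
-- (b̄_{v,∞} = 2-adic limit of b̄_{v,t}, t → ∞)
BbarInfRes : ℕ → ℕ → ℕ → ℕ → Set
BbarInfRes b v n s = ∃ λ T → ∀ t → T ≤ t → _%_ (bbar b v t) (2 ℕ.^ n) {{m^n≢0 2 n}} ≡ s

{-# OPTIONS --safe #-}
-- Φ reads binary digits from the bottom, so it is affine under concatenation:
-- for a < 2^k, Φ(a + 2^k y) = Φ(a) + 2^k 3^(-α(a)) Φ(y).  For every u the number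
-- a + 2^k b̄_{v,t+u} is the concatenation of a + 2^k b̄_{v,t} (k + tv digits, α(a) + mt
-- of them ones) with b̄_{v,u}, which gives the identity exactly for these truncations.
-- Modulo 2^n, Φ of a natural number only depends on its residue mod 2^n (the digits
-- from position n on contribute 2^n times a 2-adic integer), and for u large the
-- residues of a + 2^k b̄_{v,t+u} and of b̄_{v,u} are r and s.
module Submission where

open import Defs

module Binary where

  open import Data.Nat
  open import Data.Nat.Properties
  open import Data.Nat.DivMod
  open import Data.Nat.Divisibility
  open import Relation.Binary.PropositionalEquality

  _%2^_ : ℕ → ℕ → ℕ
  x %2^ n = _%_ x (2 ^ n) {{m^n≢0 2 n}}

  n<2^n : ∀ n → n < 2 ^ n
  n<2^n zero    = z<s
  n<2^n (suc n) = ≤-<-trans (n<2^n n)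
    (subst (2 ^ n <_) (*-comm (2 ^ n) 2) (m<m*n (2 ^ n) 2 (s≤s (s≤s z≤n))))
    where instance _ = m^n≢0 2 n

  2^-mono-∣ : ∀ {m n} → m ≤ n → 2 ^ m ∣ 2 ^ n
  2^-mono-∣ {m} {n} m≤n = divides (2 ^ (n ∸ m))
    (trans (cong (2 ^_) (sym (m∸n+n≡m m≤n))) (^-distribˡ-+-* 2 (n ∸ m) m))

  +-2^*-< : ∀ {a y} k e → a < 2 ^ k → y < 2 ^ e → a + 2 ^ k * y < 2 ^ (k + e)
  +-2^*-< {a} {y} k e a<2^k y<2^e = begin-strict
    a + 2 ^ k * y      <⟨ +-monoˡ-< (2 ^ k * y) a<2^k ⟩
    2 ^ k + 2 ^ k * y  ≡⟨ *-suc (2 ^ k) y ⟨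
    2 ^ k * suc y      ≤⟨ *-monoʳ-≤ (2 ^ k) y<2^e ⟩
    2 ^ k * 2 ^ e      ≡⟨ ^-distribˡ-+-* 2 k e ⟨
    2 ^ (k + e)        ∎
    where open ≤-Reasoning

  bit-+-2^*ˡ : ∀ {i k} a y → i < k → bit i (a + 2 ^ k * y) ≡ bit i a
  bit-+-2^*ˡ {i} {k} a y i<k = begin
    bit i (a + 2 ^ k * y)               ≡⟨ bit≡%/ (a + 2 ^ k * y) ⟩
    (a + 2 ^ k * y) % 2 ^ suc i / 2 ^ i ≡⟨ /-congˡ (%-remove-+ʳ a 2^1+i∣2^k*y) ⟩
    a % 2 ^ suc i / 2 ^ i               ≡⟨ bit≡%/ a ⟨
    bit i a                             ∎
    where
    open ≡-Reasoning
    instance _ = m^n≢0 2 i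
             _ = m^n≢0 2 (suc i)
    bit≡%/ : ∀ x → bit i x ≡ x % 2 ^ suc i / 2 ^ i
    bit≡%/ x = sym (m%[n*o]/o≡m/o%n x 2 (2 ^ i))
    2^1+i∣2^k*y : 2 ^ suc i ∣ 2 ^ k * y
    2^1+i∣2^k*y = ∣-trans (2^-mono-∣ i<k) (m∣m*n y)

  bit-+-2^*ʳ : ∀ {a} k e y → a < 2 ^ k → bit (k + e) (a + 2 ^ k * y) ≡ bit e y
  bit-+-2^*ʳ {a} k e y a<2^k = cong (_% 2) (begin
    (a + 2 ^ k * y) / 2 ^ (k + e)       ≡⟨ /-congʳ (^-distribˡ-+-* 2 k e) ⟩
    (a + 2 ^ k * y) / (2 ^ k * 2 ^ e)   ≡⟨ m/n/o≡m/[n*o] (a + 2 ^ k * y) (2 ^ k) (2 ^ e) ⟨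
    (a + 2 ^ k * y) / 2 ^ k / 2 ^ e     ≡⟨ /-congˡ [a+2^k*y]/2^k≡y ⟩
    y / 2 ^ e                           ∎)
    where
    open ≡-Reasoning
    instance _ = m^n≢0 2 k
             _ = m^n≢0 2 e
             _ = m^n≢0 2 (k + e)
             _ = m*n≢0 (2 ^ k) (2 ^ e)
    [a+2^k*y]/2^k≡y : (a + 2 ^ k * y) / 2 ^ k ≡ y
    [a+2^k*y]/2^k≡y = begin
      (a + 2 ^ k * y) / 2 ^ k        ≡⟨ /-congˡ (cong (a +_) (*-comm (2 ^ k) y)) ⟩
      (a + y * 2 ^ k) / 2 ^ k        ≡⟨ +-distrib-/-∣ʳ a (n∣m*n y) ⟩
      a / 2 ^ k + y * 2 ^ k / 2 ^ k  ≡⟨ cong₂ _+_ (m<n⇒m/n≡0 a<2^k) (m*n/n≡m y (2 ^ k)) ⟩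
      y                              ∎

  <2^⇒bit≡0 : ∀ {x e} i → x < 2 ^ e → e ≤ i → bit i x ≡ 0
  <2^⇒bit≡0 i x<2^e e≤i = cong (_% 2) (m<n⇒m/n≡0 (<-≤-trans x<2^e (^-monoʳ-≤ 2 e≤i)))
    where instance _ = m^n≢0 2 i

module Embedding where

  open import Data.Nat as ℕ using (ℕ; zero; suc)
  import Data.Nat.Properties as ℕₚ
  open import Data.Integer as ℤ using (+_)
  import Data.Integer.Properties as ℤₚ
  open import Data.Rational using (ℚ; _+_; _*_; _-_; toℚᵘ)
  open import Data.Rational.Solver using (module +-*-Solver)
  open +-*-Solver using (solve; _:=_; _:+_; _:-_)
  open import Data.Rational.Properties
    using (toℚᵘ-injective; toℚᵘ-fromℚᵘ; toℚᵘ-homo-+; toℚᵘ-homo-*; *-identityˡ; *-assoc)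
  open import Data.Rational.Unnormalised as ℚᵘ using (mkℚᵘ; *≡*; _≃_)
  import Data.Rational.Unnormalised.Properties as ℚᵘₚ
  open import Relation.Binary.PropositionalEquality

  toℚᵘ-⟦⟧ : ∀ m → toℚᵘ ⟦ m ⟧ ≃ mkℚᵘ (+ m) 0
  -- ⟦ m ⟧ is definitionally fromℚᵘ (mkℚᵘ (+ m) 0).
  toℚᵘ-⟦⟧ m = toℚᵘ-fromℚᵘ (mkℚᵘ (+ m) 0)

  ⟦⟧-+ : ∀ m n → ⟦ m ℕ.+ n ⟧ ≡ ⟦ m ⟧ + ⟦ n ⟧
  ⟦⟧-+ m n = toℚᵘ-injective (begin
    toℚᵘ ⟦ m ℕ.+ n ⟧                ≈⟨ toℚᵘ-⟦⟧ (m ℕ.+ n) ⟩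
    mkℚᵘ (+ (m ℕ.+ n)) 0            ≈⟨ *≡* (cong (ℤ._* + 1) +[m+n]≡+m*1++n*1) ⟩
    mkℚᵘ (+ m) 0 ℚᵘ.+ mkℚᵘ (+ n) 0  ≈⟨ ℚᵘₚ.+-cong (toℚᵘ-⟦⟧ m) (toℚᵘ-⟦⟧ n) ⟨
    toℚᵘ ⟦ m ⟧ ℚᵘ.+ toℚᵘ ⟦ n ⟧      ≈⟨ toℚᵘ-homo-+ ⟦ m ⟧ ⟦ n ⟧ ⟨
    toℚᵘ (⟦ m ⟧ + ⟦ n ⟧)            ∎)
    where
    open ℚᵘₚ.≃-Reasoning
    +[m+n]≡+m*1++n*1 : + (m ℕ.+ n) ≡ + m ℤ.* + 1 ℤ.+ + n ℤ.* + 1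
    +[m+n]≡+m*1++n*1 = trans (ℤₚ.pos-+ m n)
      (sym (cong₂ ℤ._+_ (ℤₚ.*-identityʳ (+ m)) (ℤₚ.*-identityʳ (+ n))))

  ⟦⟧-∸ : ∀ {m n} → n ℕ.≤ m → ⟦ m ℕ.∸ n ⟧ ≡ ⟦ m ⟧ - ⟦ n ⟧
  ⟦⟧-∸ {m} {n} n≤m = begin
    ⟦ m ℕ.∸ n ⟧                    ≡⟨ solve 2 (λ x y → y := (x :+ y) :- x) refl ⟦ n ⟧ ⟦ m ℕ.∸ n ⟧ ⟩
    (⟦ n ⟧ + ⟦ m ℕ.∸ n ⟧) - ⟦ n ⟧  ≡⟨ cong (_- ⟦ n ⟧) (⟦⟧-+ n (m ℕ.∸ n)) ⟨
    ⟦ n ℕ.+ (m ℕ.∸ n) ⟧ - ⟦ n ⟧    ≡⟨ cong (λ k → ⟦ k ⟧ - ⟦ n ⟧) (ℕₚ.m+[n∸m]≡n n≤m) ⟩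
    ⟦ m ⟧ - ⟦ n ⟧                  ∎
    where open ≡-Reasoning

  ⟦⟧-* : ∀ m n → ⟦ m ℕ.* n ⟧ ≡ ⟦ m ⟧ * ⟦ n ⟧
  ⟦⟧-* m n = toℚᵘ-injective (begin
    toℚᵘ ⟦ m ℕ.* n ⟧                ≈⟨ toℚᵘ-⟦⟧ (m ℕ.* n) ⟩
    mkℚᵘ (+ (m ℕ.* n)) 0            ≈⟨ *≡* (cong (ℤ._* + 1) (ℤₚ.pos-* m n)) ⟩
    mkℚᵘ (+ m) 0 ℚᵘ.* mkℚᵘ (+ n) 0  ≈⟨ ℚᵘₚ.*-cong (toℚᵘ-⟦⟧ m) (toℚᵘ-⟦⟧ n) ⟨
    toℚᵘ ⟦ m ⟧ ℚᵘ.* toℚᵘ ⟦ n ⟧      ≈⟨ toℚᵘ-homo-* ⟦ m ⟧ ⟦ n ⟧ ⟨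
    toℚᵘ (⟦ m ⟧ * ⟦ n ⟧)            ∎)
    where open ℚᵘₚ.≃-Reasoning

  ^ℚ-distribˡ-+-* : ∀ x m n → x ^ℚ (m ℕ.+ n) ≡ x ^ℚ m * x ^ℚ n
  ^ℚ-distribˡ-+-* x zero    n = sym (*-identityˡ (x ^ℚ n))
  ^ℚ-distribˡ-+-* x (suc m) n =
    trans (cong (x *_) (^ℚ-distribˡ-+-* x m n)) (sym (*-assoc x (x ^ℚ m) (x ^ℚ n)))

module TwoAdic where

  open import Data.Nat as ℕ using (ℕ; zero; suc; _≤_; _^_; _∸_)
  open import Data.Nat.Properties using (m^n≢0; 1+n≢0; *-identityˡ; *-comm; *-assoc; ≤-total; m+[n∸m]≡n)
  open import Data.Nat.DivMod using (_%_; %-distribˡ-*; m%n<n; %-remove-+ʳ)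
  open import Data.Nat.Divisibility
  open import Data.Nat.Primality using (euclidsLemma; prime[2])
  open import Data.Integer as ℤ using (+_; ∣_∣)
  open import Data.Integer.Properties using (abs-*; *-identityʳ)
  open import Data.Rational using (ℚ; mkℚ; _+_; _*_; _-_; -_; ↥_; ↧_; ↧ₙ_; toℚᵘ)
  import Data.Rational.Properties as ℚₚ
  open import Data.Rational.Unnormalised as ℚᵘ using (mkℚᵘ; *≡*)
  import Data.Rational.Unnormalised.Properties as ℚᵘₚ
  open import Data.Rational.Solver using (module +-*-Solver)
  open +-*-Solver using (solve; _:=_; _:+_; _:*_; _:-_; :-_)
  open import Data.Sum using (inj₁; inj₂)
  open import Data.Product using (_,_)
  open import Relation.Nullary using (contradiction)
  open import Relation.Binary.PropositionalEquality
  open Binary using (_%2^_)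
  open Embedding

  odd-* : ∀ m n → m % 2 ≡ 1 → n % 2 ≡ 1 → m ℕ.* n % 2 ≡ 1
  odd-* m n m-odd n-odd = trans (%-distribˡ-* m n 2) (cong₂ (λ i j → i ℕ.* j % 2) m-odd n-odd)

  odd-*⇒oddˡ : ∀ m n → m ℕ.* n % 2 ≡ 1 → m % 2 ≡ 1
  odd-*⇒oddˡ m n mn-odd with m % 2 | %-distribˡ-* m n 2 | m%n<n m 2
  ... | 0           | mn%2≡0 | _ = contradiction (trans (sym mn-odd) mn%2≡0) 1+n≢0
  ... | 1           | _      | _ = refl
  ... | suc (suc _) | _      | ℕ.s≤s (ℕ.s≤s ())

  2^n∣m*odd⇒2^n∣m : ∀ n {m d} → d % 2 ≡ 1 → 2 ^ n ∣ m ℕ.* d → 2 ^ n ∣ m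
  2^n∣m*odd⇒2^n∣m zero    {m} _ _ = 1∣ m
  2^n∣m*odd⇒2^n∣m (suc n) {m} {d} d-odd 2^1+n∣md
    with euclidsLemma m d prime[2] (m*n∣⇒m∣ 2 (2 ^ n) 2^1+n∣md)
  ... | inj₂ 2∣d = contradiction (trans (sym d-odd) (n∣m⇒m%n≡0 d 2 2∣d)) 1+n≢0
  ... | inj₁ (divides-refl m') = subst (2 ^ suc n ∣_) (*-comm 2 m') (*-monoʳ-∣ 2 2^n∣m')
    where
    2^n∣m' : 2 ^ n ∣ m'
    2^n∣m' = 2^n∣m*odd⇒2^n∣m n d-odd (*-cancelˡ-∣ 2
      (subst (2 ^ suc n ∣_) (trans (cong (ℕ._* d) (*-comm m' 2)) (*-assoc 2 m' d)) 2^1+n∣md))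

  ↧*≡odd⇒InZ₂ : ∀ p g m → ↧ p ℤ.* g ≡ + m → m % 2 ≡ 1 → InZ₂ p
  ↧*≡odd⇒InZ₂ p g m ↧p*g≡m m-odd = odd-*⇒oddˡ (↧ₙ p) ∣ g ∣
    (subst (λ k → k % 2 ≡ 1) (trans (cong ∣_∣ (sym ↧p*g≡m)) (abs-* (↧ p) g)) m-odd)

  InZ₂-+ : ∀ p q → InZ₂ p → InZ₂ q → InZ₂ (p + q)
  InZ₂-+ p@record{} q@record{} p∈ℤ₂ q∈ℤ₂ =
    ↧*≡odd⇒InZ₂ (p + q) _ (↧ₙ p ℕ.* ↧ₙ q) (ℚₚ.↧-+ p q) (odd-* (↧ₙ p) (↧ₙ q) p∈ℤ₂ q∈ℤ₂)

  InZ₂-* : ∀ p q → InZ₂ p → InZ₂ q → InZ₂ (p * q)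
  InZ₂-* p@record{} q@record{} p∈ℤ₂ q∈ℤ₂ =
    ↧*≡odd⇒InZ₂ (p * q) _ (↧ₙ p ℕ.* ↧ₙ q) (ℚₚ.↧-* p q) (odd-* (↧ₙ p) (↧ₙ q) p∈ℤ₂ q∈ℤ₂)

  InZ₂-neg : ∀ p → InZ₂ p → InZ₂ (- p)
  InZ₂-neg p p∈ℤ₂ = subst (λ k → ∣ k ∣ % 2 ≡ 1) (sym (ℚₚ.↧-neg p)) p∈ℤ₂

  InZ₂-- : ∀ p q → InZ₂ p → InZ₂ q → InZ₂ (p - q)
  InZ₂-- p q p∈ℤ₂ q∈ℤ₂ = InZ₂-+ p (- q) p∈ℤ₂ (InZ₂-neg q q∈ℤ₂)

  InZ₂-⟦⟧ : ∀ n → InZ₂ ⟦ n ⟧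
  InZ₂-⟦⟧ n = ↧*≡odd⇒InZ₂ ⟦ n ⟧ _ 1 (ℚₚ.↧-/ (+ n) 1) refl

  InZ₂-^ℚ : ∀ p j → InZ₂ p → InZ₂ (p ^ℚ j)
  InZ₂-^ℚ p zero    _    = refl
  InZ₂-^ℚ p (suc j) p∈ℤ₂ = InZ₂-* p (p ^ℚ j) p∈ℤ₂ (InZ₂-^ℚ p j p∈ℤ₂)

  InZ₂-inv3^ : ∀ j → InZ₂ (inv3^ j)
  InZ₂-inv3^ j = InZ₂-^ℚ third j refl

  mod2^-sym : ∀ {n x y} → x ≡ y [mod2^ n ] → y ≡ x [mod2^ n ]
  mod2^-sym {n} {x} {y} (z , z∈ℤ₂ , x-y≡2ⁿz) = - z , InZ₂-neg z z∈ℤ₂ , (begin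
    y - x              ≡⟨ solve 2 (λ x y → y :- x := :- (x :- y)) refl x y ⟩
    - (x - y)          ≡⟨ cong -_ x-y≡2ⁿz ⟩
    - (⟦ 2 ^ n ⟧ * z)  ≡⟨ ℚₚ.neg-distribʳ-* ⟦ 2 ^ n ⟧ z ⟩
    ⟦ 2 ^ n ⟧ * - z    ∎)
    where open ≡-Reasoning

  mod2^-trans : ∀ {n x y w} → x ≡ y [mod2^ n ] → y ≡ w [mod2^ n ] → x ≡ w [mod2^ n ]
  mod2^-trans {n} {x} {y} {w} (z , z∈ℤ₂ , x-y≡2ⁿz) (z' , z'∈ℤ₂ , y-w≡2ⁿz') =
    z + z' , InZ₂-+ z z' z∈ℤ₂ z'∈ℤ₂ , (begin
    x - w                              ≡⟨ solve 3 (λ x y w → x :- w := (x :- y) :+ (y :- w)) refl x y w ⟩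
    (x - y) + (y - w)                  ≡⟨ cong₂ _+_ x-y≡2ⁿz y-w≡2ⁿz' ⟩
    ⟦ 2 ^ n ⟧ * z + ⟦ 2 ^ n ⟧ * z'     ≡⟨ ℚₚ.*-distribˡ-+ ⟦ 2 ^ n ⟧ z z' ⟨
    ⟦ 2 ^ n ⟧ * (z + z')               ∎)
    where open ≡-Reasoning

  mod2^--cong : ∀ {n x x' y y'} → x ≡ x' [mod2^ n ] → y ≡ y' [mod2^ n ] → (x - y) ≡ (x' - y') [mod2^ n ]
  mod2^--cong {n} {x} {x'} {y} {y'} (z , z∈ℤ₂ , x-x'≡2ⁿz) (z' , z'∈ℤ₂ , y-y'≡2ⁿz') =
    z - z' , InZ₂-- z z' z∈ℤ₂ z'∈ℤ₂ , (begin
    (x - y) - (x' - y')                ≡⟨ solve 4 (λ x x' y y' → (x :- y) :- (x' :- y') := (x :- x') :- (y :- y'))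
                                            refl x x' y y' ⟩
    (x - x') - (y - y')                ≡⟨ cong₂ _-_ x-x'≡2ⁿz y-y'≡2ⁿz' ⟩
    ⟦ 2 ^ n ⟧ * z - ⟦ 2 ^ n ⟧ * z'     ≡⟨ solve 3 (λ N z z' → N :* z :- N :* z' := N :* (z :- z')) refl ⟦ 2 ^ n ⟧ z z' ⟩
    ⟦ 2 ^ n ⟧ * (z - z')               ∎)
    where open ≡-Reasoning

  mod2^-*-congˡ : ∀ {n x y} c → InZ₂ c → x ≡ y [mod2^ n ] → (c * x) ≡ (c * y) [mod2^ n ]
  mod2^-*-congˡ {n} {x} {y} c c∈ℤ₂ (z , z∈ℤ₂ , x-y≡2ⁿz) = c * z , InZ₂-* c z c∈ℤ₂ z∈ℤ₂ , (begin
    c * x - c * y        ≡⟨ solve 3 (λ c x y → c :* x :- c :* y := c :* (x :- y)) refl c x y ⟩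
    c * (x - y)          ≡⟨ cong (c *_) x-y≡2ⁿz ⟩
    c * (⟦ 2 ^ n ⟧ * z)  ≡⟨ solve 3 (λ c N z → c :* (N :* z) := N :* (c :* z)) refl c ⟦ 2 ^ n ⟧ z ⟩
    ⟦ 2 ^ n ⟧ * (c * z)  ∎)
    where open ≡-Reasoning

  ⟦m⟧≡⟦n⟧*p⇒m*↧p≡n*∣↥p∣ : ∀ m n p → ⟦ m ⟧ ≡ ⟦ n ⟧ * p → m ℕ.* ↧ₙ p ≡ n ℕ.* ∣ ↥ p ∣
  ⟦m⟧≡⟦n⟧*p⇒m*↧p≡n*∣↥p∣ m n p@(mkℚ c d-1 _) ⟦m⟧≡⟦n⟧*p = cross-multiply toℚᵘ-cross
    where
    toℚᵘ-cross : mkℚᵘ (+ m) 0 ℚᵘ.≃ mkℚᵘ (+ n) 0 ℚᵘ.* mkℚᵘ c d-1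
    toℚᵘ-cross = begin
      mkℚᵘ (+ m) 0                   ≈⟨ toℚᵘ-⟦⟧ m ⟨
      toℚᵘ ⟦ m ⟧                     ≈⟨ ℚᵘₚ.≃-reflexive (cong toℚᵘ ⟦m⟧≡⟦n⟧*p) ⟩
      toℚᵘ (⟦ n ⟧ * p)               ≈⟨ ℚₚ.toℚᵘ-homo-* ⟦ n ⟧ p ⟩
      toℚᵘ ⟦ n ⟧ ℚᵘ.* toℚᵘ p         ≈⟨ ℚᵘₚ.*-cong (toℚᵘ-⟦⟧ n) ℚᵘₚ.≃-refl ⟩
      mkℚᵘ (+ n) 0 ℚᵘ.* mkℚᵘ c d-1   ∎
      where open ℚᵘₚ.≃-Reasoning
    cross-multiply : mkℚᵘ (+ m) 0 ℚᵘ.≃ mkℚᵘ (+ n) 0 ℚᵘ.* mkℚᵘ c d-1 → m ℕ.* suc d-1 ≡ n ℕ.* ∣ c ∣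
    cross-multiply (*≡* m*[1+d]≡n*c*1) = begin
      m ℕ.* suc d-1                 ≡⟨ cong (m ℕ.*_) (*-identityˡ (suc d-1)) ⟨
      m ℕ.* (1 ℕ.* suc d-1)         ≡⟨ abs-* (+ m) (+ (1 ℕ.* suc d-1)) ⟨
      ∣ + m ℤ.* + (1 ℕ.* suc d-1) ∣ ≡⟨ cong ∣_∣ m*[1+d]≡n*c*1 ⟩
      ∣ + n ℤ.* c ℤ.* + 1 ∣         ≡⟨ cong ∣_∣ (*-identityʳ (+ n ℤ.* c)) ⟩
      ∣ + n ℤ.* c ∣                 ≡⟨ abs-* (+ n) c ⟩
      n ℕ.* ∣ c ∣                   ∎
      where open ≡-Reasoning

  ⟦⟧-mod2^∧≤⇒%2^≡ : ∀ {n x y} → y ≤ x → ⟦ x ⟧ ≡ ⟦ y ⟧ [mod2^ n ] → x %2^ n ≡ y %2^ n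
  ⟦⟧-mod2^∧≤⇒%2^≡ {n} {x} {y} y≤x (z , z∈ℤ₂ , ⟦x⟧-⟦y⟧≡2ⁿz) = begin
    x %2^ n                ≡⟨ cong (_%2^ n) (m+[n∸m]≡n y≤x) ⟨
    (y ℕ.+ (x ∸ y)) %2^ n  ≡⟨ %-remove-+ʳ y 2ⁿ∣x∸y ⟩
    y %2^ n                ∎
    where
    open ≡-Reasoning
    instance _ = m^n≢0 2 n
    [x∸y]*↧z≡2ⁿ*∣↥z∣ : (x ∸ y) ℕ.* ↧ₙ z ≡ 2 ^ n ℕ.* ∣ ↥ z ∣
    [x∸y]*↧z≡2ⁿ*∣↥z∣ = ⟦m⟧≡⟦n⟧*p⇒m*↧p≡n*∣↥p∣ (x ∸ y) (2 ^ n) z (trans (⟦⟧-∸ y≤x) ⟦x⟧-⟦y⟧≡2ⁿz)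
    2ⁿ∣x∸y : 2 ^ n ∣ x ∸ y
    2ⁿ∣x∸y = 2^n∣m*odd⇒2^n∣m n z∈ℤ₂
      (divides ∣ ↥ z ∣ (trans [x∸y]*↧z≡2ⁿ*∣↥z∣ (*-comm (2 ^ n) ∣ ↥ z ∣)))

  ⟦⟧-mod2^⇒%2^≡ : ∀ {n x y} → ⟦ x ⟧ ≡ ⟦ y ⟧ [mod2^ n ] → x %2^ n ≡ y %2^ n
  ⟦⟧-mod2^⇒%2^≡ {n} {x} {y} x≡y with ≤-total y x
  ... | inj₁ y≤x = ⟦⟧-mod2^∧≤⇒%2^≡ {n} {x} {y} y≤x x≡y
  ... | inj₂ x≤y = sym (⟦⟧-mod2^∧≤⇒%2^≡ {n} {y} {x} x≤y (mod2^-sym {n} {⟦ x ⟧} {⟦ y ⟧} x≡y))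

module DigitSums where

  open import Data.Nat as ℕ using (ℕ; zero; suc; _<_; _^_)
  import Data.Nat.Properties as ℕₚ
  import Algebra.Properties.CommutativeSemigroup ℕₚ.*-commutativeSemigroup as ℕ-*
  open import Data.Nat.DivMod using (_/_; m≡m%n+[m/n]*n; m%n<n)
  open import Data.Rational using (ℚ; 0ℚ; _+_; _*_; _-_)
  import Data.Rational.Properties as ℚₚ
  open import Data.Rational.Solver using (module +-*-Solver)
  open +-*-Solver using (solve; _:=_; _:+_; _:*_; _:-_)
  open import Data.Product using (_,_)
  open import Relation.Binary.PropositionalEquality
  open Binary
  open Embedding
  open TwoAdic

  popBelow-cong : ∀ e {x y} → (∀ {i} → i < e → bit i x ≡ bit i y) → popBelow e x ≡ popBelow e y
  popBelow-cong zero    _       = refl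
  popBelow-cong (suc e) bits-eq =
    cong₂ ℕ._+_ (popBelow-cong e (λ i<e → bits-eq (ℕₚ.m<n⇒m<1+n i<e))) (bits-eq ℕₚ.≤-refl)

  ΦUpTo-cong : ∀ e {x y} → (∀ {i} → i < e → bit i x ≡ bit i y) → ΦUpTo e x ≡ ΦUpTo e y
  ΦUpTo-cong zero    _               = refl
  ΦUpTo-cong (suc e) {x} {y} bits-eq = cong₂ _-_ (ΦUpTo-cong e bits-eq-below)
    (cong₂ (λ b p → ⟦ b ℕ.* 2 ^ e ⟧ * inv3^ p) (bits-eq ℕₚ.≤-refl) (popBelow-cong e bits-eq-below))
    where
    bits-eq-below : ∀ {i} → i < e → bit i x ≡ bit i y
    bits-eq-below i<e = bits-eq (ℕₚ.m<n⇒m<1+n i<e)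

  popBelow-suc-bit0 : ∀ e {x} → bit e x ≡ 0 → popBelow (suc e) x ≡ popBelow e x
  popBelow-suc-bit0 e {x} bit≡0 = trans (cong (popBelow e x ℕ.+_) bit≡0) (ℕₚ.+-identityʳ _)

  ΦUpTo-suc-bit0 : ∀ e {x} → bit e x ≡ 0 → ΦUpTo (suc e) x ≡ ΦUpTo e x
  ΦUpTo-suc-bit0 e {x} bit≡0 = begin
    ΦUpTo e x - ⟦ bit e x ℕ.* 2 ^ e ⟧ * inv3^ (popBelow e x)
      ≡⟨ cong (λ b → ΦUpTo e x - ⟦ b ℕ.* 2 ^ e ⟧ * inv3^ (popBelow e x)) bit≡0 ⟩
    ΦUpTo e x - 0ℚ * inv3^ (popBelow e x)  ≡⟨ cong (ΦUpTo e x -_) (ℚₚ.*-zeroˡ (inv3^ (popBelow e x))) ⟩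
    ΦUpTo e x - 0ℚ                         ≡⟨ ℚₚ.+-identityʳ (ΦUpTo e x) ⟩
    ΦUpTo e x                              ∎
    where open ≡-Reasoning

  popBelow-+ : ∀ {x} e → x < 2 ^ e → ∀ d → popBelow (e ℕ.+ d) x ≡ popBelow e x
  popBelow-+ {x} e x<2^e zero    = cong (λ j → popBelow j x) (ℕₚ.+-identityʳ e)
  popBelow-+ {x} e x<2^e (suc d) rewrite ℕₚ.+-suc e d =
    trans (popBelow-suc-bit0 (e ℕ.+ d) (<2^⇒bit≡0 (e ℕ.+ d) x<2^e (ℕₚ.m≤m+n e d))) (popBelow-+ e x<2^e d)

  ΦUpTo-+ : ∀ {x} e → x < 2 ^ e → ∀ d → ΦUpTo (e ℕ.+ d) x ≡ ΦUpTo e x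
  ΦUpTo-+ {x} e x<2^e zero    = cong (λ j → ΦUpTo j x) (ℕₚ.+-identityʳ e)
  ΦUpTo-+ {x} e x<2^e (suc d) rewrite ℕₚ.+-suc e d =
    trans (ΦUpTo-suc-bit0 (e ℕ.+ d) (<2^⇒bit≡0 (e ℕ.+ d) x<2^e (ℕₚ.m≤m+n e d))) (ΦUpTo-+ e x<2^e d)

  popBelow≡α : ∀ {x} e → x < 2 ^ e → popBelow e x ≡ α x
  popBelow≡α {x} e x<2^e = begin
    popBelow e x        ≡⟨ popBelow-+ e x<2^e x ⟨
    popBelow (e ℕ.+ x) x ≡⟨ cong (λ j → popBelow j x) (ℕₚ.+-comm e x) ⟩
    popBelow (x ℕ.+ e) x ≡⟨ popBelow-+ x (n<2^n x) e ⟩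
    α x                 ∎
    where open ≡-Reasoning

  ΦUpTo≡Φℕ : ∀ {x} e → x < 2 ^ e → ΦUpTo e x ≡ Φℕ x
  ΦUpTo≡Φℕ {x} e x<2^e = begin
    ΦUpTo e x           ≡⟨ ΦUpTo-+ e x<2^e x ⟨
    ΦUpTo (e ℕ.+ x) x    ≡⟨ cong (λ j → ΦUpTo j x) (ℕₚ.+-comm e x) ⟩
    ΦUpTo (x ℕ.+ e) x    ≡⟨ ΦUpTo-+ x (n<2^n x) e ⟩
    Φℕ x                ∎
    where open ≡-Reasoning

  popBelow-+-2^* : ∀ {a} k y → a < 2 ^ k → ∀ e →
                   popBelow (k ℕ.+ e) (a ℕ.+ 2 ^ k ℕ.* y) ≡ popBelow k a ℕ.+ popBelow e y
  popBelow-+-2^* {a} k y a<2^k zero rewrite ℕₚ.+-identityʳ k =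
    trans (popBelow-cong k (bit-+-2^*ˡ a y)) (sym (ℕₚ.+-identityʳ (popBelow k a)))
  popBelow-+-2^* {a} k y a<2^k (suc e) rewrite ℕₚ.+-suc k e =
    trans (cong₂ ℕ._+_ (popBelow-+-2^* k y a<2^k e) (bit-+-2^*ʳ k e y a<2^k))
          (ℕₚ.+-assoc (popBelow k a) (popBelow e y) (bit e y))

  ΦUpTo-+-2^* : ∀ {a} k y → a < 2 ^ k → ∀ e →
                ΦUpTo (k ℕ.+ e) (a ℕ.+ 2 ^ k ℕ.* y) ≡ ΦUpTo k a + ⟦ 2 ^ k ⟧ * inv3^ (popBelow k a) * ΦUpTo e y
  ΦUpTo-+-2^* {a} k y a<2^k zero rewrite ℕₚ.+-identityʳ k = begin
    ΦUpTo k (a ℕ.+ 2 ^ k ℕ.* y)   ≡⟨ ΦUpTo-cong k (bit-+-2^*ˡ a y) ⟩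
    ΦUpTo k a                     ≡⟨ ℚₚ.+-identityʳ (ΦUpTo k a) ⟨
    ΦUpTo k a + 0ℚ                ≡⟨ cong (ΦUpTo k a +_) (ℚₚ.*-zeroʳ (⟦ 2 ^ k ⟧ * inv3^ (popBelow k a))) ⟨
    ΦUpTo k a + ⟦ 2 ^ k ⟧ * inv3^ (popBelow k a) * 0ℚ ∎
    where open ≡-Reasoning
  ΦUpTo-+-2^* {a} k y a<2^k (suc e) rewrite ℕₚ.+-suc k e = begin
    ΦUpTo (k ℕ.+ e) X - ⟦ bit (k ℕ.+ e) X ℕ.* 2 ^ (k ℕ.+ e) ⟧ * inv3^ (popBelow (k ℕ.+ e) X)
      ≡⟨ cong₂ (λ S t → S - t) (ΦUpTo-+-2^* k y a<2^k e)
           (cong₂ (λ b p → ⟦ b ℕ.* 2 ^ (k ℕ.+ e) ⟧ * inv3^ p) (bit-+-2^*ʳ k e y a<2^k) (popBelow-+-2^* k y a<2^k e)) ⟩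
    (A + P * I * S) - ⟦ b ℕ.* 2 ^ (k ℕ.+ e) ⟧ * inv3^ (popBelow k a ℕ.+ popBelow e y)
      ≡⟨ cong₂ (λ u w → (A + P * I * S) - u * w) ⟦b*2^[k+e]⟧≡P*B (^ℚ-distribˡ-+-* third (popBelow k a) (popBelow e y)) ⟩
    (A + P * I * S) - (P * B) * (I * I')
      ≡⟨ solve 6 (λ A P I S B J → (A :+ P :* I :* S) :- (P :* B) :* (I :* J) := A :+ P :* I :* (S :- B :* J))
           refl A P I S B I' ⟩
    A + P * I * (S - B * I') ∎
    where
    open ≡-Reasoning
    X = a ℕ.+ 2 ^ k ℕ.* y
    A = ΦUpTo k a
    P = ⟦ 2 ^ k ⟧
    I = inv3^ (popBelow k a)
    I' = inv3^ (popBelow e y)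
    S = ΦUpTo e y
    b = bit e y
    B = ⟦ b ℕ.* 2 ^ e ⟧
    ⟦b*2^[k+e]⟧≡P*B : ⟦ b ℕ.* 2 ^ (k ℕ.+ e) ⟧ ≡ P * B
    ⟦b*2^[k+e]⟧≡P*B = trans (cong ⟦_⟧ b*2^[k+e]≡2^k*[b*2^e]) (⟦⟧-* (2 ^ k) (b ℕ.* 2 ^ e))
      where
      b*2^[k+e]≡2^k*[b*2^e] : b ℕ.* 2 ^ (k ℕ.+ e) ≡ 2 ^ k ℕ.* (b ℕ.* 2 ^ e)
      b*2^[k+e]≡2^k*[b*2^e] = begin
        b ℕ.* 2 ^ (k ℕ.+ e)        ≡⟨ cong (b ℕ.*_) (ℕₚ.^-distribˡ-+-* 2 k e) ⟩
        b ℕ.* (2 ^ k ℕ.* 2 ^ e)    ≡⟨ ℕ-*.x∙yz≈y∙xz b (2 ^ k) (2 ^ e) ⟩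
        2 ^ k ℕ.* (b ℕ.* 2 ^ e)    ∎

  α-+-2^* : ∀ {a} k y → a < 2 ^ k → α (a ℕ.+ 2 ^ k ℕ.* y) ≡ α a ℕ.+ α y
  α-+-2^* {a} k y a<2^k = begin
    α (a ℕ.+ 2 ^ k ℕ.* y)                      ≡⟨ popBelow≡α (k ℕ.+ y) (+-2^*-< k y a<2^k (n<2^n y)) ⟨
    popBelow (k ℕ.+ y) (a ℕ.+ 2 ^ k ℕ.* y)     ≡⟨ popBelow-+-2^* k y a<2^k y ⟩
    popBelow k a ℕ.+ α y                        ≡⟨ cong (ℕ._+ α y) (popBelow≡α k a<2^k) ⟩
    α a ℕ.+ α y                                 ∎
    where open ≡-Reasoning

  Φℕ-+-2^* : ∀ {a} k y → a < 2 ^ k → Φℕ (a ℕ.+ 2 ^ k ℕ.* y) ≡ Φℕ a + ⟦ 2 ^ k ⟧ * inv3^ (α a) * Φℕ y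
  Φℕ-+-2^* {a} k y a<2^k = begin
    Φℕ (a ℕ.+ 2 ^ k ℕ.* y)                      ≡⟨ ΦUpTo≡Φℕ (k ℕ.+ y) (+-2^*-< k y a<2^k (n<2^n y)) ⟨
    ΦUpTo (k ℕ.+ y) (a ℕ.+ 2 ^ k ℕ.* y)         ≡⟨ ΦUpTo-+-2^* k y a<2^k y ⟩
    ΦUpTo k a + ⟦ 2 ^ k ⟧ * inv3^ (popBelow k a) * Φℕ y
      ≡⟨ cong₂ (λ S p → S + ⟦ 2 ^ k ⟧ * inv3^ p * Φℕ y) (ΦUpTo≡Φℕ k a<2^k) (popBelow≡α k a<2^k) ⟩
    Φℕ a + ⟦ 2 ^ k ⟧ * inv3^ (α a) * Φℕ y        ∎
    where open ≡-Reasoning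

  InZ₂-ΦUpTo : ∀ e x → InZ₂ (ΦUpTo e x)
  InZ₂-ΦUpTo zero    x = refl
  InZ₂-ΦUpTo (suc e) x = InZ₂-- (ΦUpTo e x) _ (InZ₂-ΦUpTo e x)
    (InZ₂-* ⟦ bit e x ℕ.* 2 ^ e ⟧ _ (InZ₂-⟦⟧ (bit e x ℕ.* 2 ^ e)) (InZ₂-inv3^ (popBelow e x)))

  Φℕ-mod2^-residue : ∀ {n x r} → x %2^ n ≡ r → Φℕ x ≡ Φℕ r [mod2^ n ]
  Φℕ-mod2^-residue {n} {x} refl = w , w∈ℤ₂ , (begin
    Φℕ x - Φℕ r                         ≡⟨ cong (λ y → Φℕ y - Φℕ r) x≡r+2ⁿq ⟩
    Φℕ (r ℕ.+ 2 ^ n ℕ.* q) - Φℕ r        ≡⟨ cong (_- Φℕ r) (Φℕ-+-2^* n q r<2ⁿ) ⟩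
    (Φℕ r + ⟦ 2 ^ n ⟧ * I * Φℕ q) - Φℕ r ≡⟨ solve 4 (λ R N I Q → (R :+ N :* I :* Q) :- R := N :* (I :* Q))
                                             refl (Φℕ r) ⟦ 2 ^ n ⟧ I (Φℕ q) ⟩
    ⟦ 2 ^ n ⟧ * w                       ∎)
    where
    open ≡-Reasoning
    instance _ = ℕₚ.m^n≢0 2 n
    r = x %2^ n
    q = x / 2 ^ n
    I = inv3^ (α r)
    w = I * Φℕ q
    w∈ℤ₂ : InZ₂ w
    w∈ℤ₂ = InZ₂-* I (Φℕ q) (InZ₂-inv3^ (α r)) (InZ₂-ΦUpTo q q)
    r<2ⁿ : r < 2 ^ n
    r<2ⁿ = m%n<n x (2 ^ n)
    x≡r+2ⁿq : x ≡ r ℕ.+ 2 ^ n ℕ.* q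
    x≡r+2ⁿq = trans (m≡m%n+[m/n]*n x (2 ^ n)) (cong (r ℕ.+_) (ℕₚ.*-comm q (2 ^ n)))

open import Data.Nat as ℕ using (ℕ; zero; suc; _<_; _≤_; _+_; _*_; _^_)
import Data.Nat.Properties as ℕₚ
import Algebra.Properties.CommutativeSemigroup ℕₚ.*-commutativeSemigroup as ℕ-*
open import Data.Nat.DivMod using (m<n⇒m%n≡m)
open import Data.Rational as ℚ using (ℚ)
open import Data.Rational.Solver using (module +-*-Solver)
open +-*-Solver using (solve; _:=_; _:+_; _:*_; _:-_)
open import Data.Product using (∃; _,_; proj₁; proj₂)
open import Relation.Binary.PropositionalEquality
open Binary
open TwoAdic
open DigitSums

bbar-< : ∀ {b} v → b < 2 ^ v → ∀ t → bbar b v t < 2 ^ (v * t)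
bbar-< v b<2^v zero    = ℕₚ.m^n>0 2 (v * 0)
bbar-< {b} v b<2^v (suc t) = subst₂ _<_
  (cong (bbar b v t +_) (ℕₚ.*-comm (2 ^ (v * t)) b))
  (cong (2 ^_) (trans (ℕₚ.+-comm (v * t) v) (sym (ℕₚ.*-suc v t))))
  (+-2^*-< (v * t) v (bbar-< v b<2^v t) b<2^v)

bbar-+ : ∀ b v t u → bbar b v (t + u) ≡ bbar b v t + 2 ^ (v * t) * bbar b v u
bbar-+ b v t zero = trans (cong (bbar b v) (ℕₚ.+-identityʳ t))
  (sym (trans (cong (bbar b v t +_) (ℕₚ.*-zeroʳ (2 ^ (v * t)))) (ℕₚ.+-identityʳ (bbar b v t))))
bbar-+ b v t (suc u) rewrite ℕₚ.+-suc t u = begin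
  bbar b v (t + u) + b * 2 ^ (v * (t + u))
    ≡⟨ cong₂ _+_ (bbar-+ b v t u) (cong (λ j → b * 2 ^ j) (ℕₚ.*-distribˡ-+ v t u)) ⟩
  bbar b v t + P * bbar b v u + b * 2 ^ (v * t + v * u)
    ≡⟨ cong (λ j → bbar b v t + P * bbar b v u + b * j) (ℕₚ.^-distribˡ-+-* 2 (v * t) (v * u)) ⟩
  bbar b v t + P * bbar b v u + b * (P * 2 ^ (v * u))
    ≡⟨ ℕₚ.+-assoc (bbar b v t) _ _ ⟩
  bbar b v t + (P * bbar b v u + b * (P * 2 ^ (v * u)))
    ≡⟨ cong (λ j → bbar b v t + (P * bbar b v u + j)) (ℕ-*.x∙yz≈y∙xz b P (2 ^ (v * u))) ⟩
  bbar b v t + (P * bbar b v u + P * (b * 2 ^ (v * u)))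
    ≡⟨ cong (bbar b v t +_) (ℕₚ.*-distribˡ-+ P (bbar b v u) _) ⟨
  bbar b v t + P * (bbar b v u + b * 2 ^ (v * u)) ∎
  where
  open ≡-Reasoning
  P = 2 ^ (v * t)

α-bbar : ∀ {b} v → b < 2 ^ v → ∀ t → α (bbar b v t) ≡ α b * t
α-bbar {b} v b<2^v zero    = sym (ℕₚ.*-zeroʳ (α b))
α-bbar {b} v b<2^v (suc t) = begin
  α (bbar b v t + b * 2 ^ (v * t))    ≡⟨ cong (λ j → α (bbar b v t + j)) (ℕₚ.*-comm b (2 ^ (v * t))) ⟩
  α (bbar b v t + 2 ^ (v * t) * b)    ≡⟨ α-+-2^* (v * t) b (bbar-< v b<2^v t) ⟩
  α (bbar b v t) + α b                ≡⟨ cong (_+ α b) (α-bbar v b<2^v t) ⟩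
  α b * t + α b                       ≡⟨ ℕₚ.+-comm (α b * t) (α b) ⟩
  α b + α b * t                       ≡⟨ ℕₚ.*-suc (α b) t ⟨
  α b * suc t                         ∎
  where open ≡-Reasoning

Φℕ-bbar-+ : ∀ {a b} k v t u → a < 2 ^ k → b < 2 ^ v →
            Φℕ (a + 2 ^ k * bbar b v (t + u))
              ≡ Φℕ (a + 2 ^ k * bbar b v t)
                ℚ.+ ⟦ 2 ^ (k + t * v) ⟧ ℚ.* inv3^ (α b * t + α a) ℚ.* Φℕ (bbar b v u)
Φℕ-bbar-+ {a} {b} k v t u a<2^k b<2^v = begin
  Φℕ (a + 2 ^ k * bbar b v (t + u))        ≡⟨ cong Φℕ X'≡X+2^K*Y ⟩
  Φℕ (X + 2 ^ K * Y)                        ≡⟨ Φℕ-+-2^* K Y X<2^K ⟩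
  Φℕ X ℚ.+ ⟦ 2 ^ K ⟧ ℚ.* inv3^ (α X) ℚ.* Φℕ Y
    ≡⟨ cong (λ j → Φℕ X ℚ.+ ⟦ 2 ^ K ⟧ ℚ.* inv3^ j ℚ.* Φℕ Y) αX≡ ⟩
  Φℕ X ℚ.+ ⟦ 2 ^ K ⟧ ℚ.* inv3^ (α b * t + α a) ℚ.* Φℕ Y ∎
  where
  open ≡-Reasoning
  X = a + 2 ^ k * bbar b v t
  Y = bbar b v u
  K = k + t * v
  X<2^K : X < 2 ^ K
  X<2^K = subst (λ j → X < 2 ^ (k + j)) (ℕₚ.*-comm v t) (+-2^*-< k (v * t) a<2^k (bbar-< v b<2^v t))
  αX≡ : α X ≡ α b * t + α a
  αX≡ = trans (α-+-2^* k (bbar b v t) a<2^k)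
          (trans (cong (α a +_) (α-bbar v b<2^v t)) (ℕₚ.+-comm (α a) (α b * t)))
  X'≡X+2^K*Y : a + 2 ^ k * bbar b v (t + u) ≡ X + 2 ^ K * Y
  X'≡X+2^K*Y = begin
    a + 2 ^ k * bbar b v (t + u)                     ≡⟨ cong (λ j → a + 2 ^ k * j) (bbar-+ b v t u) ⟩
    a + 2 ^ k * (bbar b v t + 2 ^ (v * t) * Y)       ≡⟨ cong (a +_) (ℕₚ.*-distribˡ-+ (2 ^ k) (bbar b v t) _) ⟩
    a + (2 ^ k * bbar b v t + 2 ^ k * (2 ^ (v * t) * Y)) ≡⟨ ℕₚ.+-assoc a _ _ ⟨
    X + 2 ^ k * (2 ^ (v * t) * Y)                    ≡⟨ cong (X +_) (ℕₚ.*-assoc (2 ^ k) (2 ^ (v * t)) Y) ⟨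
    X + 2 ^ k * 2 ^ (v * t) * Y                      ≡⟨ cong (λ j → X + j * Y) (ℕₚ.^-distribˡ-+-* 2 k (v * t)) ⟨
    X + 2 ^ (k + v * t) * Y                          ≡⟨ cong (λ j → X + 2 ^ (k + j) * Y) (ℕₚ.*-comm v t) ⟩
    X + 2 ^ K * Y                                    ∎

theorem13 : (q : ℚ) (a k b v : ℕ) → a < 2 ^ k → b < 2 ^ v
    → InZ₂ q
    → (∀ n → ∃ λ T → ∀ t → T ≤ t → q ≡ ⟦ a + 2 ^ k * bbar b v t ⟧ [mod2^ n ])
    → (t : ℕ) → 1 ≤ t
    → (n r s : ℕ) → r < 2 ^ n → q ≡ ⟦ r ⟧ [mod2^ n ] → BbarInfRes b v n s
    → Φℕ (a + 2 ^ k * bbar b v t)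
    ≡ Φℕ r ℚ.- Φℕ s ℚ.* ⟦ 2 ^ (k + t * v) ⟧ ℚ.* inv3^ (α b * t + α a) [mod2^ n ]
theorem13 q a k b v a<2^k b<2^v _ q≡Xₜ t _ n r s r<2ⁿ q≡r (T , bbar≡s) =
  subst₂ (λ L R → L ≡ R [mod2^ n ]) (sym ΦX≡ΦX'-cΦY) cΦs≡ΦsPI
    (mod2^--cong {n} {Φℕ X'} {Φℕ r} {c ℚ.* Φℕ Y} {c ℚ.* Φℕ s} ΦX'≡Φr
      (mod2^-*-congˡ {n} {Φℕ Y} {Φℕ s} c c∈ℤ₂ ΦY≡Φs))
  where
  T' = proj₁ (q≡Xₜ n)
  u = T + T'
  X = a + 2 ^ k * bbar b v t
  X' = a + 2 ^ k * bbar b v (t + u)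
  Y = bbar b v u
  P = ⟦ 2 ^ (k + t * v) ⟧
  I = inv3^ (α b * t + α a)
  c = P ℚ.* I
  c∈ℤ₂ : InZ₂ c
  c∈ℤ₂ = InZ₂-* P I (InZ₂-⟦⟧ (2 ^ (k + t * v))) (InZ₂-inv3^ (α b * t + α a))
  cΦs≡ΦsPI : Φℕ r ℚ.- c ℚ.* Φℕ s ≡ Φℕ r ℚ.- Φℕ s ℚ.* P ℚ.* I
  cΦs≡ΦsPI = solve 4 (λ R S P I → R :- P :* I :* S := R :- S :* P :* I) refl (Φℕ r) (Φℕ s) P I
  ΦX≡ΦX'-cΦY : Φℕ X ≡ Φℕ X' ℚ.- c ℚ.* Φℕ Y
  ΦX≡ΦX'-cΦY = begin
    Φℕ X                                   ≡⟨ solve 3 (λ A C B → A := (A :+ C :* B) :- C :* B) refl (Φℕ X) c (Φℕ Y) ⟩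
    (Φℕ X ℚ.+ c ℚ.* Φℕ Y) ℚ.- c ℚ.* Φℕ Y   ≡⟨ cong (ℚ._- c ℚ.* Φℕ Y) (Φℕ-bbar-+ k v t u a<2^k b<2^v) ⟨
    Φℕ X' ℚ.- c ℚ.* Φℕ Y                   ∎
    where open ≡-Reasoning
  q≡X' : q ≡ ⟦ X' ⟧ [mod2^ n ]
  q≡X' = proj₂ (q≡Xₜ n) (t + u) (ℕₚ.≤-trans (ℕₚ.m≤n+m T' T) (ℕₚ.m≤n+m u t))
  X'%2ⁿ≡r : X' %2^ n ≡ r
  X'%2ⁿ≡r = trans (⟦⟧-mod2^⇒%2^≡ {n} {X'} {r} (mod2^-trans {n} {⟦ X' ⟧} {q} {⟦ r ⟧} (mod2^-sym {n} {q} {⟦ X' ⟧} q≡X') q≡r)) (m<n⇒m%n≡m {{ℕₚ.m^n≢0 2 n}} r<2ⁿ)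
  ΦX'≡Φr : Φℕ X' ≡ Φℕ r [mod2^ n ]
  ΦX'≡Φr = Φℕ-mod2^-residue {n} {X'} X'%2ⁿ≡r
  ΦY≡Φs : Φℕ Y ≡ Φℕ s [mod2^ n ]
  ΦY≡Φs = Φℕ-mod2^-residue {n} {Y} (bbar≡s u (ℕₚ.m≤m+n T T'))
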